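{- Let $k\ge 2$, and let $m$ and $u$ be positive integers. Let $\vec b=(b_0,b_1,\dots)$ and $\vec c=(c_0,c_1,\dots)$ be infinite sequences of integers. Then the sequence $\{\widehat{C}^{\vec b,\vec c}_{k,u,n} \bmod m\}_{n\ge 0}$ is eventually periodic.
   Context: A $k$-dimensional balanced ballot path of length $kn$ is a sequence $P=(\vec s_1,\dots,\vec s_{kn})$ of standard unit vectors of $\mathbb{R}^k$ in which each $\vec e_i$ occurs exactly $n$ times and every intermediate point $\vec v_i=\sum_{j=1}^i\vec s_j$ ($0\le i\le kn$), $\vec x=(x_1,\dots,x_k)$, satisfies $x_1\ge\cdots\ge x_k$. The semisymmetric height of $\vec x\in\mathbb{Z}^k_{\ge 0}$ is $g_k(\vec x)=\sum_{i=1}^k(k+1-2i)x_i$; the semisymmetric height $g_k(P)$ of a path is the maximum of $g_k$ over its intermediate points (the empty path has height $0$). A step $\vec e_i$ is a semisymmetric up-step if $i\le\lfloor k/2\rfloor$; all other steps (down-steps $\vec e_j$ with $j\ge k-\lfloor k/2\rfloor+1$, and for odd $k$ the neutral step $\vec e_{\lfloor k/2\rfloor+1}$) are non-up-steps. The semisymmetric weight of $P$ is $sswt_{\vec b,\vec c}(P)=\prod b_{u_i}\cdot\prod c_{u'_j}$, where the first product runs over the up-steps of $P$ and $u_i$ is the semisymmetric height of the starting point of the $i$-th up-step, and the second product runs over the non-up-steps of $P$ and $u'_j$ is the semisymmetric height of the resulting point of the $j$-th non-up-step. Define $\widehat{C}^{\vec b,\vec c}_{k,u,n}=\sum_P sswt_{\vec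 b,\vec c}(P)$, the sum over all $k$-dimensional balanced ballot paths $P$ of length $kn$ with $g_k(P)\le u$. -}

module Defs where

open import Data.Nat as ℕ using (ℕ; zero; suc; _/_; _<ᵇ_; _≡ᵇ_)
open import Data.Integer as ℤ using (ℤ; +_; _⊔_; ∣_∣; _≤?_)
import Data.Fin
open import Data.Fin using (Fin; toℕ; _≟_)
open import Data.Bool using (Bool; true; false; if_then_else_; _∧_)
open import Data.List using (List; []; _∷_; length; concatMap; map; filter; allFin; foldr)
open import Relation.Nullary.Decidable using (⌊_⌋)

sumℤ : List ℤ → ℤ
sumℤ = foldr ℤ._+_ (+ 0)

-- A lattice point of ℤ^k with nonnegative coordinates, coordinates indexed 0..k-1
-- (coordinate i here is x_{i+1} in the paper).
Point : ℕ → Set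
Point k = Fin k → ℕ

origin : ∀ {k} → Point k
origin _ = 0

step : ∀ {k} → Point k → Fin k → Point k
step x i j = if ⌊ i ≟ j ⌋ then suc (x j) else x j

-- A path is the list of its steps; step i ∈ Fin k stands for e_{i+1}.
Path : ℕ → Set
Path k = List (Fin k)

words : (k ℓ : ℕ) → List (Path k)
words k zero = [] ∷ []
words k (suc ℓ) = concatMap (λ i → map (i ∷_) (words k ℓ)) (allFin k)

pointsFrom : ∀ {k} → Point k → Path k → List (Point k)
pointsFrom x [] = x ∷ []
pointsFrom x (i ∷ p) = x ∷ pointsFrom (step x i) p

points : ∀ {k} → Path k → List (Point k)
points = pointsFrom origin

weaklyDecreasingFrom : ∀ {k} → (Fin k → ℕ) → Bool
weaklyDecreasingFrom {zero} x = true
weaklyDecreasingFrom {suc zero} x = true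
weaklyDecreasingFrom {suc (suc k)} x =
  ⌊ x (Data.Fin.suc Data.Fin.zero) ℕ.≤? x Data.Fin.zero ⌋ ∧ weaklyDecreasingFrom {suc k} (λ j → x (Data.Fin.suc j))

allB : ∀ {A : Set} → (A → Bool) → List A → Bool
allB P = foldr (λ a r → P a ∧ r) true

count : ∀ {k} → Fin k → Path k → ℕ
count i p = length (filter (λ j → i ≟ j) p)

isBalancedBallot : ∀ k → ℕ → Path k → Bool
isBalancedBallot k n p =
  allB (λ i → count i p ≡ᵇ n) (allFin k) ∧ allB weaklyDecreasingFrom (points p)

-- semisymmetric height g_k(x) = Σ_{i=1}^k (k+1-2i) x_i ; with 0-indexed i this is
-- Σ_{i=0}^{k-1} (k-1-2i) x_i
g : ∀ k → Point k → ℤ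
g k x = sumℤ (map (λ i → (+ k ℤ.- + 1 ℤ.- + (2 ℕ.* toℕ i)) ℤ.* + x i) (allFin k))

-- semisymmetric height of a path: max of g over intermediate points
-- (the list of points always contains v_0, whose height is 0)
gPath : ∀ k → Path k → ℤ
gPath k p = foldr (λ x r → g k x ⊔ r) (+ 0) (points p)

-- e_i (paper index i = toℕ i + 1) is an up-step iff i ≤ ⌊k/2⌋
isUp : ∀ k → Fin k → Bool
isUp k i = toℕ i <ᵇ (k / 2)

-- semisymmetric weight, walking from the point x.
-- Heights of points on a ballot path are ≥ 0; the index into b, c is ∣ height ∣.
sswtFrom : ∀ k → (b c : ℕ → ℤ) → Point k → Path k → ℤ
sswtFrom k b c x [] = + 1
sswtFrom k b c x (i ∷ p) =
  (if isUp k i then b ∣ g k x ∣ else c ∣ g k (step x i) ∣) ℤ.* sswtFrom k b c (step x i) p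

sswt : ∀ k → (b c : ℕ → ℤ) → Path k → ℤ
sswt k b c = sswtFrom k b c origin

Chat : (k u n : ℕ) → (b c : ℕ → ℤ) → ℤ
Chat k u n b c =
  sumℤ (map (λ p → if isBalancedBallot k n p ∧ ⌊ gPath k p ≤? + u ⌋ then sswt k b c p else + 0)
           (words k (k ℕ.* n)))

{-# OPTIONS --safe #-}
-- Ĉ_{k,u,n} is the weighted sum over walks of length kn from the origin back to the diagonal
-- all of whose points are admissible (ballot, and of height at most u). Admissibility and the
-- weights are invariant under translation along the diagonal, since the height coefficients
-- k+1−2i sum to zero; and an admissible point has spread x₁ − x_k ≤ g_k(x) ≤ u. Hence admissible
-- points fall into at most (u+1)^k translation classes, and the weighted sums W_ℓ of walks of
-- length ℓ, as functions of the starting class, obey a fixed linear recurrence W_{ℓ+1} = Φ(W_ℓ).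
-- Reduced mod m, the vector of values of W_ℓ ranges over a finite set and evolves by a fixed map,
-- so it is eventually periodic by pigeonhole; Ĉ_{k,u,n} mod m is read off from it at ℓ = kn.
module Submission where

open import Defs
open import Algebra.Bundles using (CommutativeMonoid)
open import Data.Bool using (Bool; true; false; if_then_else_; _∧_; T)
import Data.Bool.Properties as BoolP
open import Data.Fin using (Fin; zero; suc; toℕ; fromℕ; fromℕ<; _≟_)
import Data.Fin.Properties as FinP
open import Data.Fin.Base using (funToFin; finToFun)
open import Data.List using (List; []; _∷_; _++_; map; concatMap; length; foldr; foldl; allFin)
import Data.List.Properties as ListP
open import Data.List.Relation.Unary.All as All using (All; []; _∷_)
open import Data.List.Relation.Unary.All.Properties using (concat⁺; map⁺)
open import Data.List.Membership.Propositional.Properties using (∈-allFin)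
open import Data.Nat as ℕ using (ℕ; zero; suc; z≤n; s≤s; NonZero)
import Data.Nat.Properties as ℕP
open import Data.Nat.DivMod using (m<n⇒m%n≡m)
open import Data.Nat.Divisibility using (n∣m⇒m%n≡0) renaming (_∣_ to _∣ℕ_)
open import Data.Nat.GeneralisedArithmetic using (fold)
open import Data.Integer using (ℤ; +_; +≤+; ∣_∣)
import Data.Integer.Properties as ℤP
open import Data.Integer.DivMod using (_%_; _/_; n%d<d; a≡a%n+[a/n]*n)
open import Data.Integer.Divisibility.Signed
  using (_∣_; divides; ∣m∣n⇒∣m+n; ∣m⇒∣-m; ∣n⇒∣m*n; ∣⇒∣ᵤ)
open import Data.Integer.Tactic.RingSolver using (solve-∀)
open import Data.Product using (∃₂; _×_; _,_; proj₁; proj₂)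
open import Data.Unit using (tt)
open import Relation.Nullary using (yes; no; contradiction)
open import Data.Sum using (inj₁; inj₂)
open import Data.Vec using (Vec; lookup; tabulate)
import Data.Vec.Properties as VecP
open import Function using (_∘_; id; _⇔_; mk⇔; Equivalence)
open import Function.Definitions using (Injective)
open import Relation.Binary.PropositionalEquality
open import Relation.Nullary.Decidable using (⌊_⌋; T?; toWitness; fromWitness; does-⇔)

module Sums where
  open import Data.Integer using (_+_; _*_; _≤_)

  ∑ : ∀ {A : Set} → (A → ℤ) → List A → ℤ
  ∑ f xs = sumℤ (map f xs)

  private variable A B : Set

  ∑-cong : {f h : A → ℤ} → (∀ a → f a ≡ h a) → ∀ xs → ∑ f xs ≡ ∑ h xs
  ∑-cong f≗h xs = cong sumℤ (ListP.map-cong f≗h xs)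

  ∑-cong-All : {f h : A → ℤ} {xs : List A} → All (λ a → f a ≡ h a) xs → ∑ f xs ≡ ∑ h xs
  ∑-cong-All = cong sumℤ ∘ ListP.map-cong-local

  ∑-zero : ∀ xs → ∑ (λ (_ : A) → + 0) xs ≡ + 0
  ∑-zero []       = refl
  ∑-zero (x ∷ xs) = trans (ℤP.+-identityˡ _) (∑-zero xs)

  ∑-const : ∀ c xs → ∑ (λ (_ : A) → c) xs ≡ + length xs * c
  ∑-const c []       = refl
  ∑-const c (x ∷ xs) = trans (cong (_+_ c) (∑-const c xs)) (distrib c (+ length xs))
    where
    distrib : ∀ c n → c + n * c ≡ (+ 1 + n) * c
    distrib = solve-∀

  ∑-+ : ∀ (f h : A → ℤ) xs → ∑ (λ a → f a + h a) xs ≡ ∑ f xs + ∑ h xs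
  ∑-+ f h []       = refl
  ∑-+ f h (x ∷ xs) = trans (cong (_+_ (f x + h x)) (∑-+ f h xs)) (interchange (f x) (h x) (∑ f xs) (∑ h xs))
    where
    interchange : ∀ a b c d → (a + b) + (c + d) ≡ (a + c) + (b + d)
    interchange = solve-∀

  ∑-*ˡ : ∀ c (f : A → ℤ) xs → ∑ (λ a → c * f a) xs ≡ c * ∑ f xs
  ∑-*ˡ c f []       = sym (ℤP.*-zeroʳ c)
  ∑-*ˡ c f (x ∷ xs) = trans (cong (_+_ (c * f x)) (∑-*ˡ c f xs)) (sym (ℤP.*-distribˡ-+ c (f x) (∑ f xs)))

  ∑-nonneg : {f : A → ℤ} → (∀ a → + 0 ≤ f a) → ∀ xs → + 0 ≤ ∑ f xs
  ∑-nonneg f≥0 []       = ℤP.≤-refl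
  ∑-nonneg f≥0 (x ∷ xs) = ℤP.+-mono-≤ (f≥0 x) (∑-nonneg f≥0 xs)

  ∑-++ : ∀ (f : A → ℤ) xs ys → ∑ f (xs ++ ys) ≡ ∑ f xs + ∑ f ys
  ∑-++ f []       ys = sym (ℤP.+-identityˡ _)
  ∑-++ f (x ∷ xs) ys = trans (cong (_+_ (f x)) (∑-++ f xs ys)) (sym (ℤP.+-assoc (f x) _ _))

  ∑-map : ∀ (f : B → ℤ) (h : A → B) xs → ∑ f (map h xs) ≡ ∑ (f ∘ h) xs
  ∑-map f h xs = cong sumℤ (sym (ListP.map-∘ xs))

  ∑-concatMap : ∀ (f : B → ℤ) (G : A → List B) xs →
                ∑ f (concatMap G xs) ≡ ∑ (λ a → ∑ f (G a)) xs
  ∑-concatMap f G []       = refl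
  ∑-concatMap f G (x ∷ xs) = trans (∑-++ f (G x) (concatMap G xs)) (cong (_+_ (∑ f (G x))) (∑-concatMap f G xs))

  ∑-allFin-suc : ∀ {n} (f : Fin (suc n) → ℤ) → ∑ f (allFin (suc n)) ≡ f zero + ∑ (f ∘ suc) (allFin n)
  ∑-allFin-suc f = cong (λ fs → f zero + sumℤ fs)
    (trans (ListP.map-tabulate suc f) (sym (ListP.map-tabulate id (f ∘ suc))))

open Sums

module Congruence (m : ℕ) where
  open import Data.Integer using (_+_; _-_; _*_; -_)

  infix 4 _≡ₘ_
  record _≡ₘ_ (a b : ℤ) : Set where
    constructor mk≡ₘ
    field divides-difference : + m ∣ a - b

  ≡ₘ-refl : ∀ {a} → a ≡ₘ a
  ≡ₘ-refl {a} = mk≡ₘ (divides (+ 0) (trans (ℤP.+-inverseʳ a) (sym (ℤP.*-zeroˡ (+ m)))))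

  ≡ₘ-reflexive : ∀ {a b} → a ≡ b → a ≡ₘ b
  ≡ₘ-reflexive refl = ≡ₘ-refl

  ≡ₘ-sym : ∀ {a b} → a ≡ₘ b → b ≡ₘ a
  ≡ₘ-sym {a} {b} (mk≡ₘ a≡b) = mk≡ₘ (subst (+ m ∣_) (flip a b) (∣m⇒∣-m a≡b))
    where
    flip : ∀ a b → - (a - b) ≡ b - a
    flip = solve-∀

  ≡ₘ-trans : ∀ {a b c} → a ≡ₘ b → b ≡ₘ c → a ≡ₘ c
  ≡ₘ-trans {a} {b} {c} (mk≡ₘ a≡b) (mk≡ₘ b≡c) =
    mk≡ₘ (subst (+ m ∣_) (telescope a b c) (∣m∣n⇒∣m+n a≡b b≡c))
    where
    telescope : ∀ a b c → (a - b) + (b - c) ≡ a - c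
    telescope = solve-∀

  ≡ₘ-+ : ∀ {a b c d} → a ≡ₘ b → c ≡ₘ d → a + c ≡ₘ b + d
  ≡ₘ-+ {a} {b} {c} {d} (mk≡ₘ a≡b) (mk≡ₘ c≡d) =
    mk≡ₘ (subst (+ m ∣_) (regroup a b c d) (∣m∣n⇒∣m+n a≡b c≡d))
    where
    regroup : ∀ a b c d → (a - b) + (c - d) ≡ (a + c) - (b + d)
    regroup = solve-∀

  ≡ₘ-*ˡ : ∀ c {a b} → a ≡ₘ b → c * a ≡ₘ c * b
  ≡ₘ-*ˡ c {a} {b} (mk≡ₘ a≡b) = mk≡ₘ (subst (+ m ∣_) (distrib c a b) (∣n⇒∣m*n c a≡b))
    where
    distrib : ∀ c a b → c * (a - b) ≡ c * a - c * b
    distrib = solve-∀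

  ≡ₘ-∑ : ∀ {A : Set} {f h : A → ℤ} → (∀ a → f a ≡ₘ h a) → ∀ xs → ∑ f xs ≡ₘ ∑ h xs
  ≡ₘ-∑ f≡h []       = ≡ₘ-refl
  ≡ₘ-∑ f≡h (x ∷ xs) = ≡ₘ-+ (f≡h x) (≡ₘ-∑ f≡h xs)

  module _ .{{_ : NonZero m}} where

    ≡ₘ-% : ∀ a → a ≡ₘ + (a % + m)
    ≡ₘ-% a = mk≡ₘ (divides (a / + m)
      (trans (cong (_- + (a % + m)) (a≡a%n+[a/n]*n a (+ m))) (cancel (+ (a % + m)) (a / + m) (+ m))))
      where
      cancel : ∀ r q n → (r + q * n) - r ≡ q * n
      cancel = solve-∀

    private
      residue-≡ₘ-≤ : ∀ {r s} → s ℕ.≤ r → r ℕ.< m → + r ≡ₘ + s → r ≡ s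
      residue-≡ₘ-≤ {r} {s} s≤r r<m (mk≡ₘ r≡s) = ℕP.≤-antisym (ℕP.m∸n≡0⇒m≤n r∸s≡0) s≤r
        where
        m∣r∸s : m ∣ℕ r ℕ.∸ s
        m∣r∸s = ∣⇒∣ᵤ (subst (+ m ∣_) (trans (ℤP.m-n≡m⊖n r s) (ℤP.⊖-≥ s≤r)) r≡s)
        r∸s≡0 : r ℕ.∸ s ≡ 0
        r∸s≡0 = trans (sym (m<n⇒m%n≡m (ℕP.≤-<-trans (ℕP.m∸n≤m r s) r<m))) (n∣m⇒m%n≡0 _ m m∣r∸s)

    residue-≡ₘ : ∀ {r s} → r ℕ.< m → s ℕ.< m → + r ≡ₘ + s → r ≡ s
    residue-≡ₘ {r} {s} r<m s<m r≡s with ℕP.≤-total s r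
    ... | inj₁ s≤r = residue-≡ₘ-≤ s≤r r<m r≡s
    ... | inj₂ r≤s = sym (residue-≡ₘ-≤ r≤s s<m (≡ₘ-sym r≡s))

    ≡ₘ⇒%≡ : ∀ {a b} → a ≡ₘ b → a % + m ≡ b % + m
    ≡ₘ⇒%≡ {a} {b} a≡b = residue-≡ₘ (n%d<d a (+ m)) (n%d<d b (+ m))
      (≡ₘ-trans (≡ₘ-sym (≡ₘ-% a)) (≡ₘ-trans a≡b (≡ₘ-% b)))

module Periodicity where
  open import Data.Nat using (_+_; _∸_; _^_; _≤_; _<_)

  EventuallyPeriodic : {A : Set} → (ℕ → A) → Set
  EventuallyPeriodic s = ∃₂ λ (N p : ℕ) → 0 < p × (∀ n → N ≤ n → s (n + p) ≡ s n)

  eventuallyPeriodic-factor : ∀ {A B : Set} (f : A → B) {s : ℕ → A} {t : ℕ → B} →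
    (∀ n → t n ≡ f (s n)) → EventuallyPeriodic s → EventuallyPeriodic t
  eventuallyPeriodic-factor f t≡fs (N , p , p>0 , periodic) =
    N , p , p>0 , λ n N≤n → trans (t≡fs (n + p)) (trans (cong f (periodic n N≤n)) (sym (t≡fs n)))

  module Orbit {A : Set} (T : A → A) (t : ℕ → A) (t-suc : ∀ n → t (suc n) ≡ T (t n)) where

    orbit-shift : ∀ {i j} → t i ≡ t j → ∀ d → t (d + i) ≡ t (d + j)
    orbit-shift ti≡tj zero    = ti≡tj
    orbit-shift {i} {j} ti≡tj (suc d) =
      trans (t-suc (d + i)) (trans (cong T (orbit-shift ti≡tj d)) (sym (t-suc (d + j))))

    repetition⇒eventuallyPeriodic : ∀ {i j} → i < j → t i ≡ t j → EventuallyPeriodic t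
    repetition⇒eventuallyPeriodic {i} {j} i<j ti≡tj = i , j ∸ i , ℕP.m<n⇒0<n∸m i<j , periodic
      where
      periodic : ∀ n → i ≤ n → t (n + (j ∸ i)) ≡ t n
      periodic n i≤n = begin
        t (n + (j ∸ i))           ≡⟨ cong (λ l → t (l + (j ∸ i))) (ℕP.m∸n+n≡m i≤n) ⟨
        t ((n ∸ i + i) + (j ∸ i)) ≡⟨ cong t (ℕP.+-assoc (n ∸ i) i (j ∸ i)) ⟩
        t (n ∸ i + (i + (j ∸ i))) ≡⟨ cong (λ l → t (n ∸ i + l)) (ℕP.m+[n∸m]≡n (ℕP.<⇒≤ i<j)) ⟩
        t (n ∸ i + j)             ≡⟨ orbit-shift ti≡tj (n ∸ i) ⟨
        t (n ∸ i + i)             ≡⟨ cong t (ℕP.m∸n+n≡m i≤n) ⟩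
        t n                       ∎
        where open ≡-Reasoning

    finite⇒eventuallyPeriodic : ∀ {K} (encode : A → Fin K) → Injective _≡_ _≡_ encode → EventuallyPeriodic t
    finite⇒eventuallyPeriodic {K} encode encode-injective =
      let i , j , i<j , same-code = FinP.pigeonhole (ℕP.n<1+n K) (encode ∘ t ∘ toℕ)
      in repetition⇒eventuallyPeriodic i<j (encode-injective same-code)

  encodeVec : ∀ {m M} → Vec (Fin m) M → Fin (m ^ M)
  encodeVec = funToFin ∘ lookup

  encodeVec-injective : ∀ {m M} → Injective _≡_ _≡_ (encodeVec {m} {M})
  encodeVec-injective {x = v} {y = w} same-code = begin
    v                   ≡⟨ VecP.tabulate∘lookup v ⟨
    tabulate (lookup v) ≡⟨ VecP.tabulate-cong same-entries ⟩
    tabulate (lookup w) ≡⟨ VecP.tabulate∘lookup w ⟩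
    w                   ∎
    where
    open ≡-Reasoning
    same-entries : ∀ q → lookup v q ≡ lookup w q
    same-entries q = begin
      lookup v q                      ≡⟨ FinP.finToFun-funToFin (lookup v) q ⟨
      finToFun (encodeVec v) q        ≡⟨ cong (λ code → finToFun code q) same-code ⟩
      finToFun (encodeVec w) q        ≡⟨ FinP.finToFun-funToFin (lookup w) q ⟩
      lookup w q                      ∎

open Periodicity

T⇔T⇒≡ : ∀ {a b} → T a ⇔ T b → a ≡ b
T⇔T⇒≡ {a} {b} a⇔b = does-⇔ a⇔b (T? a) (T? b)

module _ {A : Set} where

  allB-cong : {P Q : A → Bool} → (∀ a → P a ≡ Q a) → ∀ xs → allB P xs ≡ allB Q xs
  allB-cong P≗Q = ListP.foldr-cong (λ a r → cong (_∧ r) (P≗Q a)) refl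

  allB-∧ : (P Q : A → Bool) → ∀ xs → allB (λ a → P a ∧ Q a) xs ≡ allB P xs ∧ allB Q xs
  allB-∧ P Q []       = refl
  allB-∧ P Q (x ∷ xs) = trans (cong (_∧_ (P x ∧ Q x)) (allB-∧ P Q xs)) (∧-interchange (P x) (Q x) _ _)
    where
    open import Algebra.Properties.CommutativeSemigroup
      (CommutativeMonoid.commutativeSemigroup BoolP.∧-commutativeMonoid)
      using () renaming (interchange to ∧-interchange)

  T-allB : (P : A → Bool) → ∀ xs → T (allB P xs) ⇔ All (T ∘ P) xs
  T-allB P []       = mk⇔ (λ _ → []) (λ _ → tt)
  T-allB P (x ∷ xs) = mk⇔
    (λ h → let Px , rest = Equivalence.to BoolP.T-∧ h in Px ∷ Equivalence.to (T-allB P xs) rest)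
    (λ { (Px ∷ rest) → Equivalence.from BoolP.T-∧ (Px , Equivalence.from (T-allB P xs) rest) })

T-allB-allFin : ∀ {n} (P : Fin n → Bool) → T (allB P (allFin n)) ⇔ (∀ i → T (P i))
T-allB-allFin {n} P = mk⇔
  (λ h i → All.lookup (Equivalence.to (T-allB P (allFin n)) h) (∈-allFin i))
  (λ h → Equivalence.from (T-allB P (allFin n)) (All.universal h (allFin n)))

module Points where
  open import Data.Integer using (_+_; _-_; _*_; _≤_; _⊔_; _≤?_)

  infix 4 _≈[_]_
  record _≈[_]_ {n} (x : Point n) (s : ℕ) (y : Point n) : Set where
    constructor mk≈
    field coordinatewise : ∀ j → x j ≡ s ℕ.+ y j
  open _≈[_]_ public

  tail-≈ : ∀ {n} {x y : Point (suc n)} {s} → x ≈[ s ] y → x ∘ suc ≈[ s ] y ∘ suc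
  tail-≈ (mk≈ x≈y) = mk≈ (x≈y ∘ suc)

  step-≈ : ∀ {n} {x y : Point n} {s} → x ≈[ s ] y → ∀ i → step x i ≈[ s ] step y i
  step-≈ {x = x} {y} {s} (mk≈ x≈y) i = mk≈ step-coordinate
    where
    step-coordinate : ∀ j → step x i j ≡ s ℕ.+ step y i j
    step-coordinate j with i ≟ j
    ... | yes _ = trans (cong suc (x≈y j)) (sym (ℕP.+-suc s (y j)))
    ... | no _  = x≈y j

  ≤?-cancelˡ : ∀ s a b → ⌊ s ℕ.+ a ℕ.≤? s ℕ.+ b ⌋ ≡ ⌊ a ℕ.≤? b ⌋
  ≤?-cancelˡ s a b = T⇔T⇒≡ (mk⇔
    (fromWitness ∘ ℕP.+-cancelˡ-≤ s a b ∘ toWitness)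
    (fromWitness ∘ ℕP.+-monoʳ-≤ s ∘ toWitness))

  ≡ᵇ-cancelˡ : ∀ s a b → (s ℕ.+ a ℕ.≡ᵇ s ℕ.+ b) ≡ (a ℕ.≡ᵇ b)
  ≡ᵇ-cancelˡ zero    a b = refl
  ≡ᵇ-cancelˡ (suc s) a b = ≡ᵇ-cancelˡ s a b

  weaklyDecreasing-≈ : ∀ {n} {x y : Point n} {s} → x ≈[ s ] y →
                       weaklyDecreasingFrom x ≡ weaklyDecreasingFrom y
  weaklyDecreasing-≈ {zero}        _   = refl
  weaklyDecreasing-≈ {suc zero}    _   = refl
  weaklyDecreasing-≈ {suc (suc n)} {s = s} x≈y = cong₂ _∧_
    (trans (cong₂ (λ a b → ⌊ a ℕ.≤? b ⌋) (coordinatewise x≈y (suc zero)) (coordinatewise x≈y zero))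
           (≤?-cancelˡ s _ _))
    (weaklyDecreasing-≈ (tail-≈ x≈y))

  weaklyDecreasing-uncons : ∀ {n} (x : Point (suc (suc n))) → T (weaklyDecreasingFrom x) →
                            x (suc zero) ℕ.≤ x zero × T (weaklyDecreasingFrom (x ∘ suc))
  weaklyDecreasing-uncons x wd =
    let x₁≤x₀ , wd′ = Equivalence.to (BoolP.T-∧ {⌊ x (suc zero) ℕ.≤? x zero ⌋}) wd
    in toWitness x₁≤x₀ , wd′

  weaklyDecreasing⇒≤head : ∀ {n} (x : Point (suc n)) → T (weaklyDecreasingFrom x) →
                           ∀ j → x j ℕ.≤ x zero
  weaklyDecreasing⇒≤head         x wd zero    = ℕP.≤-refl
  weaklyDecreasing⇒≤head {suc n} x wd (suc j) =
    let x₁≤x₀ , wd′ = weaklyDecreasing-uncons x wd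
    in ℕP.≤-trans (weaklyDecreasing⇒≤head (x ∘ suc) wd′ j) x₁≤x₀

  weaklyDecreasing⇒last≤ : ∀ {n} (x : Point (suc n)) → T (weaklyDecreasingFrom x) →
                           ∀ j → x (fromℕ n) ℕ.≤ x j
  weaklyDecreasing⇒last≤ {zero}  x wd zero    = ℕP.≤-refl
  weaklyDecreasing⇒last≤ {suc n} x wd zero    =
    let x₁≤x₀ , wd′ = weaklyDecreasing-uncons x wd
    in ℕP.≤-trans (weaklyDecreasing⇒last≤ (x ∘ suc) wd′ zero) x₁≤x₀
  weaklyDecreasing⇒last≤ {suc n} x wd (suc j) =
    weaklyDecreasing⇒last≤ (x ∘ suc) (proj₂ (weaklyDecreasing-uncons x wd)) j

  +-∸ : ∀ {a b} → a ℕ.≤ b → + (b ℕ.∸ a) ≡ + b - + a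
  +-∸ {a} {b} a≤b = sym (trans (ℤP.m-n≡m⊖n b a) (ℤP.⊖-≥ a≤b))

  height-suc : ∀ n (x : Point (suc n)) →
               g (suc n) x ≡ ∑ (λ i → + x zero - + x (suc i)) (allFin n) + g n (x ∘ suc)
  height-suc n x = begin
    g (suc n) x
      ≡⟨ ∑-allFin-suc (term (suc n) x) ⟩
    term (suc n) x zero + ∑ (term (suc n) x ∘ suc) (allFin n)
      ≡⟨ cong (_+ ∑ (term (suc n) x ∘ suc) (allFin n)) leading ⟩
    ∑ (λ _ → + x zero) (allFin n) + ∑ (term (suc n) x ∘ suc) (allFin n)
      ≡⟨ ∑-+ (λ _ → + x zero) (term (suc n) x ∘ suc) (allFin n) ⟨
    ∑ (λ i → + x zero + term (suc n) x (suc i)) (allFin n)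
      ≡⟨ ∑-cong regroup (allFin n) ⟩
    ∑ (λ i → (+ x zero - + x (suc i)) + term n (x ∘ suc) i) (allFin n)
      ≡⟨ ∑-+ (λ i → + x zero - + x (suc i)) (term n (x ∘ suc)) (allFin n) ⟩
    ∑ (λ i → + x zero - + x (suc i)) (allFin n) + g n (x ∘ suc)
      ∎
    where
    open ≡-Reasoning
    term : ∀ n → Point n → Fin n → ℤ
    term n x i = (+ n - + 1 - + (2 ℕ.* toℕ i)) * + x i
    leading : term (suc n) x zero ≡ ∑ (λ _ → + x zero) (allFin n)
    leading = trans (coefficient (+ n) (+ x zero)) (sym (trans (∑-const (+ x zero) (allFin n))
                (cong (λ l → + l * + x zero) (ListP.length-tabulate {n = n} id))))
      where
      coefficient : ∀ n a → ((+ 1 + n) - + 1 - + 0) * a ≡ n * a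
      coefficient = solve-∀
    regroup : ∀ i → + x zero + term (suc n) x (suc i) ≡ (+ x zero - + x (suc i)) + term n (x ∘ suc) i
    regroup i = trans (cong (λ t → + x zero + (+ suc n - + 1 - t) * + x (suc i)) (cong +_ (ℕP.*-suc 2 (toℕ i))))
                      (shift (+ x zero) (+ n) (+ (2 ℕ.* toℕ i)) (+ x (suc i)))
      where
      shift : ∀ a n t b → a + ((+ 1 + n) - + 1 - (+ 2 + t)) * b ≡ (a - b) + (n - + 1 - t) * b
      shift = solve-∀

  height-≈ : ∀ {n} {x y : Point n} {s} → x ≈[ s ] y → g n x ≡ g n y
  height-≈ {zero}              _   = refl
  height-≈ {suc n} {x} {y} {s} x≈y = begin
    g (suc n) x
      ≡⟨ height-suc n x ⟩
    ∑ (λ i → + x zero - + x (suc i)) (allFin n) + g n (x ∘ suc)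
      ≡⟨ cong₂ _+_ (∑-cong gap-≈ (allFin n)) (height-≈ (tail-≈ x≈y)) ⟩
    ∑ (λ i → + y zero - + y (suc i)) (allFin n) + g n (y ∘ suc)
      ≡⟨ height-suc n y ⟨
    g (suc n) y
      ∎
    where
    open ≡-Reasoning
    cancel : ∀ s a b → (s + a) - (s + b) ≡ a - b
    cancel = solve-∀
    gap-≈ : ∀ i → + x zero - + x (suc i) ≡ + y zero - + y (suc i)
    gap-≈ i = trans (cong₂ (λ a b → + a - + b) (coordinatewise x≈y zero) (coordinatewise x≈y (suc i)))
                    (cancel (+ s) (+ y zero) (+ y (suc i)))

  spread≤height : ∀ n (x : Point (suc n)) → T (weaklyDecreasingFrom x) →
                  + x zero - + x (fromℕ n) ≤ g (suc n) x
  spread≤height zero    x _  = ℤP.≤-reflexive (trans (ℤP.+-inverseʳ (+ x zero)) (sym (height-suc 0 x)))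
  spread≤height (suc n) x wd = begin
    + x₀ - + xₗ
      ≡⟨ telescope (+ x₀) (+ x₁) (+ xₗ) ⟩
    ((+ x₀ - + x₁) + + 0) + (+ x₁ - + xₗ)
      ≤⟨ ℤP.+-mono-≤ (ℤP.+-monoʳ-≤ (+ x₀ - + x₁) rest≥0)
                     (spread≤height n (x ∘ suc) (proj₂ (weaklyDecreasing-uncons x wd))) ⟩
    ((+ x₀ - + x₁) + ∑ (λ i → + x₀ - + x (suc (suc i))) (allFin n)) + g (suc n) (x ∘ suc)
      ≡⟨ cong (_+ g (suc n) (x ∘ suc)) (∑-allFin-suc (λ i → + x₀ - + x (suc i))) ⟨
    ∑ (λ i → + x₀ - + x (suc i)) (allFin (suc n)) + g (suc n) (x ∘ suc)
      ≡⟨ height-suc (suc n) x ⟨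
    g (suc (suc n)) x
      ∎
    where
    open ℤP.≤-Reasoning
    x₀ = x zero
    x₁ = x (suc zero)
    xₗ = x (fromℕ (suc n))
    telescope : ∀ a b c → a - c ≡ ((a - b) + + 0) + (b - c)
    telescope = solve-∀
    rest≥0 : + 0 ≤ ∑ (λ i → + x₀ - + x (suc (suc i))) (allFin n)
    rest≥0 = ∑-nonneg (λ i → subst (+ 0 ≤_) (+-∸ (weaklyDecreasing⇒≤head x wd (suc (suc i)))) (+≤+ z≤n))
                      (allFin n)

  endpoint : ∀ {n} → Point n → Path n → Point n
  endpoint = foldl step

  endpoint-count : ∀ {n} (x : Point n) p j → endpoint x p j ≡ x j ℕ.+ count j p
  endpoint-count x []      j = sym (ℕP.+-identityʳ (x j))
  endpoint-count x (i ∷ p) j = trans (endpoint-count (step x i) p j) step-count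
    where
    step-count : step x i j ℕ.+ count j p ≡ x j ℕ.+ count j (i ∷ p)
    step-count with i ≟ j | j ≟ i -- step decides i ≟ j, count decides j ≟ i
    ... | yes refl | yes _   = sym (ℕP.+-suc (x j) (count j p))
    ... | yes refl | no i≢i  = contradiction refl i≢i
    ... | no i≢j   | yes refl = contradiction refl i≢j
    ... | no _     | no _    = refl

  ∑-indicator : ∀ {n} (i : Fin n) → ∑ (λ j → if ⌊ j ≟ i ⌋ then + 1 else + 0) (allFin n) ≡ + 1
  ∑-indicator {suc n} i = trans (∑-allFin-suc (λ j → if ⌊ j ≟ i ⌋ then + 1 else + 0)) (rest i)
    where
    rest : ∀ i → (if ⌊ zero ≟ i ⌋ then + 1 else + 0)
                 + ∑ (λ j → if ⌊ suc j ≟ i ⌋ then + 1 else + 0) (allFin n) ≡ + 1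
    rest zero    = cong (_+_ (+ 1)) (∑-zero (allFin n))
    rest (suc i) = trans (ℤP.+-identityˡ _)
      (trans (∑-cong (λ j → cong (if_then + 1 else + 0) (suc≟suc j i)) (allFin n)) (∑-indicator i))
      where
      suc≟suc : ∀ (j i : Fin n) → ⌊ suc j ≟ suc i ⌋ ≡ ⌊ j ≟ i ⌋
      suc≟suc j i with j ≟ i
      ... | yes _ = refl
      ... | no _  = refl

  ∑-count : ∀ {n} (p : Path n) → ∑ (λ j → + count j p) (allFin n) ≡ + length p
  ∑-count {n} []      = ∑-zero (allFin n)
  ∑-count {n} (i ∷ p) = begin
    ∑ (λ j → + count j (i ∷ p)) (allFin n)
      ≡⟨ ∑-cong count-∷ (allFin n) ⟩
    ∑ (λ j → indicator j + + count j p) (allFin n)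
      ≡⟨ ∑-+ indicator (λ j → + count j p) (allFin n) ⟩
    ∑ indicator (allFin n) + ∑ (λ j → + count j p) (allFin n)
      ≡⟨ cong₂ _+_ (∑-indicator i) (∑-count p) ⟩
    + length (i ∷ p)
      ∎
    where
    open ≡-Reasoning
    indicator : Fin n → ℤ
    indicator j = if ⌊ j ≟ i ⌋ then + 1 else + 0
    count-∷ : ∀ j → + count j (i ∷ p) ≡ indicator j + + count j p
    count-∷ j with j ≟ i
    ... | yes _ = refl
    ... | no _  = refl

  ⊔-≤? : ∀ a b c → ⌊ a ⊔ b ≤? c ⌋ ≡ ⌊ a ≤? c ⌋ ∧ ⌊ b ≤? c ⌋
  ⊔-≤? a b c = T⇔T⇒≡ (mk⇔ split join)
    where
    split : T ⌊ a ⊔ b ≤? c ⌋ → T (⌊ a ≤? c ⌋ ∧ ⌊ b ≤? c ⌋)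
    split h = Equivalence.from (BoolP.T-∧ {⌊ a ≤? c ⌋})
      ( fromWitness (ℤP.≤-trans (ℤP.i≤i⊔j a b) (toWitness h))
      , fromWitness (ℤP.≤-trans (ℤP.i≤j⊔i a b) (toWitness h)))
    join : T (⌊ a ≤? c ⌋ ∧ ⌊ b ≤? c ⌋) → T ⌊ a ⊔ b ≤? c ⌋
    join h = let a≤c , b≤c = Equivalence.to (BoolP.T-∧ {⌊ a ≤? c ⌋}) h
             in fromWitness (ℤP.⊔-lub (toWitness a≤c) (toWitness b≤c))

  maximum≤? : ∀ {A : Set} (f : A → ℤ) v xs →
              ⌊ foldr (λ a r → f a ⊔ r) (+ 0) xs ≤? + v ⌋ ≡ allB (λ a → ⌊ f a ≤? + v ⌋) xs
  maximum≤? f v []       = refl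
  maximum≤? f v (x ∷ xs) = trans (⊔-≤? (f x) _ (+ v)) (cong (_∧_ ⌊ f x ≤? + v ⌋) (maximum≤? f v xs))

  words-length : ∀ k ℓ → All (λ p → length p ≡ ℓ) (words k ℓ)
  words-length k zero    = refl ∷ []
  words-length k (suc ℓ) =
    concat⁺ (map⁺ (All.universal (λ i → map⁺ (All.map (cong suc) (words-length k ℓ))) (allFin k)))

open Points

module Walks (k-1 u : ℕ) (b c : ℕ → ℤ) where
  open import Data.Integer using (_+_; _-_; _*_; _≤?_)

  k : ℕ
  k = suc k-1

  last : Fin k
  last = fromℕ k-1

  admissible : Point k → Bool
  admissible x = weaklyDecreasingFrom x ∧ ⌊ g k x ≤? + u ⌋

  onDiagonal : Point k → Bool
  onDiagonal x = allB (λ j → x j ℕ.≡ᵇ x zero) (allFin k)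

  weight : Point k → Fin k → ℤ
  weight x i = if isUp k i then b ∣ g k x ∣ else c ∣ g k (step x i) ∣

  extend : (Point k → ℤ) → Point k → ℤ
  extend f x = if admissible x then ∑ (λ i → weight x i * f (step x i)) (allFin k) else + 0

  walkSum : ℕ → Point k → ℤ
  walkSum zero    x = if admissible x ∧ onDiagonal x then + 1 else + 0
  walkSum (suc ℓ) x = extend (walkSum ℓ) x

  accepted : Point k → Path k → Bool
  accepted x []      = admissible x ∧ onDiagonal x
  accepted x (i ∷ p) = admissible x ∧ accepted (step x i) p

  ∑accepted≡walkSum : ∀ ℓ x →
    ∑ (λ p → if accepted x p then sswtFrom k b c x p else + 0) (words k ℓ) ≡ walkSum ℓ x
  ∑accepted≡walkSum zero    x = ℤP.+-identityʳ _
  ∑accepted≡walkSum (suc ℓ) x = begin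
    ∑ F (concatMap (λ i → map (i ∷_) ws) (allFin k)) ≡⟨ ∑-concatMap F (λ i → map (i ∷_) ws) (allFin k) ⟩
    ∑ (λ i → ∑ F (map (i ∷_) ws)) (allFin k)         ≡⟨ ∑-cong (λ i → ∑-map F (i ∷_) ws) (allFin k) ⟩
    ∑ (λ i → ∑ (F ∘ (i ∷_)) ws) (allFin k)           ≡⟨ first-step (admissible x) ⟩
    walkSum (suc ℓ) x                                ∎
    where
    open ≡-Reasoning
    ws = words k ℓ
    F : Path k → ℤ
    F p = if accepted x p then sswtFrom k b c x p else + 0
    guarded-* : ∀ α w s → (if α then w * s else + 0) ≡ w * (if α then s else + 0)
    guarded-* true  w s = refl
    guarded-* false w s = sym (ℤP.*-zeroʳ w)
    first-step : ∀ α →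
      ∑ (λ i → ∑ (λ p → if α ∧ accepted (step x i) p
                           then weight x i * sswtFrom k b c (step x i) p else + 0) ws) (allFin k)
      ≡ (if α then ∑ (λ i → weight x i * walkSum ℓ (step x i)) (allFin k) else + 0)
    first-step true  = ∑-cong (λ i → trans
      (∑-cong (λ p → guarded-* (accepted (step x i) p) (weight x i) (sswtFrom k b c (step x i) p)) ws)
      (trans (∑-*ˡ (weight x i) _ ws) (cong (weight x i *_) (∑accepted≡walkSum ℓ (step x i))))) (allFin k)
    first-step false = trans (∑-cong (λ i → ∑-zero ws) (allFin k)) (∑-zero (allFin k))

  accepted≡allB∧onDiagonal : ∀ x p →
    accepted x p ≡ allB admissible (pointsFrom x p) ∧ onDiagonal (endpoint x p)
  accepted≡allB∧onDiagonal x []      = cong (_∧ onDiagonal x) (sym (BoolP.∧-identityʳ (admissible x)))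
  accepted≡allB∧onDiagonal x (i ∷ p) =
    trans (cong (_∧_ (admissible x)) (accepted≡allB∧onDiagonal (step x i) p)) (sym (BoolP.∧-assoc (admissible x) _ _))

  balanced≡onDiagonal : ∀ n p → length p ≡ k ℕ.* n →
    allB (λ i → count i p ℕ.≡ᵇ n) (allFin k) ≡ onDiagonal (endpoint origin p)
  balanced≡onDiagonal n p len = T⇔T⇒≡ (mk⇔
    (Equivalence.from (T-allB-allFin _) ∘ balanced⇒diagonal ∘ Equivalence.to (T-allB-allFin _))
    (Equivalence.from (T-allB-allFin _) ∘ diagonal⇒balanced ∘ Equivalence.to (T-allB-allFin _)))
    where
    open ≡-Reasoning
    endpoint≡count : ∀ j → endpoint origin p j ≡ count j p
    endpoint≡count = endpoint-count origin p
    balanced⇒diagonal : (∀ i → T (count i p ℕ.≡ᵇ n)) →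
                        ∀ j → T (endpoint origin p j ℕ.≡ᵇ endpoint origin p zero)
    balanced⇒diagonal balanced j = ℕP.≡⇒≡ᵇ _ _ (begin
      endpoint origin p j    ≡⟨ endpoint≡count j ⟩
      count j p              ≡⟨ ℕP.≡ᵇ⇒≡ _ _ (balanced j) ⟩
      n                      ≡⟨ ℕP.≡ᵇ⇒≡ _ _ (balanced zero) ⟨
      count zero p           ≡⟨ endpoint≡count zero ⟨
      endpoint origin p zero ∎)
    diagonal⇒balanced : (∀ j → T (endpoint origin p j ℕ.≡ᵇ endpoint origin p zero)) →
                        ∀ i → T (count i p ℕ.≡ᵇ n)
    diagonal⇒balanced diagonal i = ℕP.≡⇒≡ᵇ _ _ (trans (count≡count₀ i) count₀≡n)
      where
      count≡count₀ : ∀ j → count j p ≡ count zero p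
      count≡count₀ j = trans (sym (endpoint≡count j)) (trans (ℕP.≡ᵇ⇒≡ _ _ (diagonal j)) (endpoint≡count zero))
      count₀≡n : count zero p ≡ n
      count₀≡n = ℕP.*-cancelˡ-≡ _ _ k (ℤP.+-injective (begin
        + (k ℕ.* count zero p)                   ≡⟨ ℤP.pos-* k (count zero p) ⟩
        + k * + count zero p                     ≡⟨ cong (λ l → + l * + count zero p) (ListP.length-tabulate {n = k} id) ⟨
        + length (allFin k) * + count zero p     ≡⟨ ∑-const (+ count zero p) (allFin k) ⟨
        ∑ (λ _ → + count zero p) (allFin k)      ≡⟨ ∑-cong (λ j → cong +_ (count≡count₀ j)) (allFin k) ⟨
        ∑ (λ j → + count j p) (allFin k)         ≡⟨ ∑-count p ⟩
        + length p                               ≡⟨ cong +_ len ⟩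
        + (k ℕ.* n)                              ∎))

  ballot∧height≡accepted : ∀ n p → length p ≡ k ℕ.* n →
    isBalancedBallot k n p ∧ ⌊ gPath k p ≤? + u ⌋ ≡ accepted origin p
  ballot∧height≡accepted n p len = begin
    (allB (λ i → count i p ℕ.≡ᵇ n) (allFin k) ∧ W) ∧ ⌊ gPath k p ≤? + u ⌋
      ≡⟨ cong₂ (λ β η → (β ∧ W) ∧ η) (balanced≡onDiagonal n p len) (maximum≤? (g k) u (points p)) ⟩
    (D ∧ W) ∧ H
      ≡⟨ BoolP.∧-assoc D W H ⟩
    D ∧ (W ∧ H)
      ≡⟨ BoolP.∧-comm D (W ∧ H) ⟩
    (W ∧ H) ∧ D
      ≡⟨ cong (_∧ D) (allB-∧ weaklyDecreasingFrom (λ x → ⌊ g k x ≤? + u ⌋) (points p)) ⟨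
    allB admissible (points p) ∧ D
      ≡⟨ accepted≡allB∧onDiagonal origin p ⟨
    accepted origin p
      ∎
    where
    open ≡-Reasoning
    W = allB weaklyDecreasingFrom (points p)
    H = allB (λ x → ⌊ g k x ≤? + u ⌋) (points p)
    D = onDiagonal (endpoint origin p)

  Chat≡walkSum : ∀ n → Chat k u n b c ≡ walkSum (k ℕ.* n) origin
  Chat≡walkSum n = trans
    (∑-cong-All (All.map (λ {p} len → cong (λ α → if α then sswt k b c p else + 0)
                                           (ballot∧height≡accepted n p len))
                         (words-length k (k ℕ.* n))))
    (∑accepted≡walkSum (k ℕ.* n) origin)

  admissible-≈ : ∀ {x y s} → x ≈[ s ] y → admissible x ≡ admissible y
  admissible-≈ x≈y = cong₂ (λ w h → w ∧ ⌊ h ≤? + u ⌋) (weaklyDecreasing-≈ x≈y) (height-≈ x≈y)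

  onDiagonal-≈ : ∀ {x y s} → x ≈[ s ] y → onDiagonal x ≡ onDiagonal y
  onDiagonal-≈ {s = s} x≈y =
    allB-cong (λ j → trans (cong₂ ℕ._≡ᵇ_ (coordinatewise x≈y j) (coordinatewise x≈y zero)) (≡ᵇ-cancelˡ s _ _))
              (allFin k)

  weight-≈ : ∀ {x y s} → x ≈[ s ] y → ∀ i → weight x i ≡ weight y i
  weight-≈ x≈y i =
    cong₂ (λ h h′ → if isUp k i then b ∣ h ∣ else c ∣ h′ ∣) (height-≈ x≈y) (height-≈ (step-≈ x≈y i))

  walkSum-≈ : ∀ ℓ {x y s} → x ≈[ s ] y → walkSum ℓ x ≡ walkSum ℓ y
  walkSum-≈ zero    x≈y = cong₂ (λ α δ → if α ∧ δ then + 1 else + 0) (admissible-≈ x≈y) (onDiagonal-≈ x≈y)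
  walkSum-≈ (suc ℓ) x≈y = cong₂ (λ α σ → if α then σ else + 0) (admissible-≈ x≈y)
    (∑-cong (λ i → cong₂ _*_ (weight-≈ x≈y i) (walkSum-≈ ℓ (step-≈ x≈y i))) (allFin k))

  walkSum-inadmissible : ∀ ℓ {x} → admissible x ≡ false → walkSum ℓ x ≡ + 0
  walkSum-inadmissible zero    {x} inadmissible = cong (λ α → if α ∧ onDiagonal x then + 1 else + 0) inadmissible
  walkSum-inadmissible (suc ℓ) {x} inadmissible =
    cong (λ α → if α then ∑ (λ i → weight x i * walkSum ℓ (step x i)) (allFin k) else + 0) inadmissible

  classCount : ℕ
  classCount = suc u ℕ.^ k

  -- Clamping at u makes normalForm total; on admissible points the clamp is inactive
  -- (admissible⇒spread≤u).
  normalForm : Point k → Fin k → Fin (suc u)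
  normalForm x j = fromℕ< (s≤s (ℕP.m⊓n≤n (x j ℕ.∸ x last) u))

  classOf : Point k → Fin classCount
  classOf x = funToFin (normalForm x)

  representative : Fin classCount → Point k
  representative q j = toℕ (finToFun q j)

  admissible⇒spread≤u : ∀ {x} → T (admissible x) → ∀ j → x j ℕ.∸ x last ℕ.≤ u
  admissible⇒spread≤u {x} adm j =
    ℕP.≤-trans (ℕP.∸-monoˡ-≤ (x last) (weaklyDecreasing⇒≤head x wd j)) (ℤP.drop‿+≤+ (begin
      + (x zero ℕ.∸ x last) ≡⟨ +-∸ (weaklyDecreasing⇒last≤ x wd zero) ⟩
      + x zero - + x last   ≤⟨ spread≤height k-1 x wd ⟩
      g k x                 ≤⟨ toWitness height≤u ⟩
      + u                   ∎))
    where
    open ℤP.≤-Reasoning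
    wd = proj₁ (Equivalence.to (BoolP.T-∧ {weaklyDecreasingFrom x}) adm)
    height≤u = proj₂ (Equivalence.to (BoolP.T-∧ {weaklyDecreasingFrom x}) adm)

  ≈representative : ∀ {x} → T (admissible x) → x ≈[ x last ] representative (classOf x)
  ≈representative {x} adm = mk≈ λ j → begin
    x j
      ≡⟨ ℕP.m+[n∸m]≡n (weaklyDecreasing⇒last≤ x wd j) ⟨
    x last ℕ.+ (x j ℕ.∸ x last)
      ≡⟨ cong (x last ℕ.+_) (ℕP.m≤n⇒m⊓n≡m (admissible⇒spread≤u adm j)) ⟨
    x last ℕ.+ ((x j ℕ.∸ x last) ℕ.⊓ u)
      ≡⟨ cong (x last ℕ.+_) (FinP.toℕ-fromℕ< _) ⟨
    x last ℕ.+ toℕ (normalForm x j)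
      ≡⟨ cong (λ i → x last ℕ.+ toℕ i) (FinP.finToFun-funToFin (normalForm x) j) ⟨
    x last ℕ.+ representative (classOf x) j
      ∎
    where
    open ≡-Reasoning
    wd = proj₁ (Equivalence.to (BoolP.T-∧ {weaklyDecreasingFrom x}) adm)

  module Residues (m : ℕ) .{{_ : NonZero m}} where
    open Congruence m

    residue : ℤ → Fin m
    residue a = fromℕ< (n%d<d a (+ m))

    residue-cong : ∀ {a b} → a ≡ₘ b → residue a ≡ residue b
    residue-cong {a} {b} a≡b = FinP.fromℕ<-cong _ _ (≡ₘ⇒%≡ a≡b) (n%d<d a (+ m)) (n%d<d b (+ m))

    State : Set
    State = Vec (Fin m) classCount

    value : State → Point k → ℤ
    value S x = if admissible x then + toℕ (lookup S (classOf x)) else + 0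

    state : ℕ → State
    state ℓ = tabulate (λ q → residue (walkSum ℓ (representative q)))

    transfer : State → State
    transfer S = tabulate (λ q → residue (extend (value S) (representative q)))

    extend-cong : ∀ {f h} → (∀ y → f y ≡ₘ h y) → ∀ x → extend f x ≡ₘ extend h x
    extend-cong f≡h x with admissible x
    ... | true  = ≡ₘ-∑ (λ i → ≡ₘ-*ˡ (weight x i) (f≡h (step x i))) (allFin k)
    ... | false = ≡ₘ-refl

    walkSum≡ₘvalue : ∀ ℓ x → walkSum ℓ x ≡ₘ value (state ℓ) x
    walkSum≡ₘvalue ℓ x = by-admissibility (admissible x) refl
      where
      q = classOf x
      by-admissibility : ∀ α → admissible x ≡ α → walkSum ℓ x ≡ₘ value (state ℓ) x
      by-admissibility true  adm = subst₂ _≡ₘ_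
        (sym (walkSum-≈ ℓ (≈representative (subst T (sym adm) tt))))
        (sym (trans (cong (λ α → if α then + toℕ (lookup (state ℓ) q) else + 0) adm)
                    (cong +_ toℕ-lookup-state)))
        (≡ₘ-% (walkSum ℓ (representative q)))
        where
        toℕ-lookup-state : toℕ (lookup (state ℓ) q) ≡ walkSum ℓ (representative q) % + m
        toℕ-lookup-state = trans (cong toℕ (VecP.lookup∘tabulate _ q)) (FinP.toℕ-fromℕ< _)
      by-admissibility false adm = ≡ₘ-reflexive
        (trans (walkSum-inadmissible ℓ adm)
               (cong (λ α → if α then + toℕ (lookup (state ℓ) q) else + 0) (sym adm)))

    state-suc : ∀ ℓ → state (suc ℓ) ≡ transfer (state ℓ)
    state-suc ℓ = VecP.tabulate-cong (λ q → residue-cong (extend-cong (walkSum≡ₘvalue ℓ) (representative q)))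

    state-+ : ∀ j ℓ → state (j ℕ.+ ℓ) ≡ fold (state ℓ) transfer j
    state-+ zero    ℓ = refl
    state-+ (suc j) ℓ = trans (state-suc (j ℕ.+ ℓ)) (cong transfer (state-+ j ℓ))

    state-k*-suc : ∀ n → state (k ℕ.* suc n) ≡ fold (state (k ℕ.* n)) transfer k
    state-k*-suc n = trans (cong state (ℕP.*-suc k n)) (state-+ k (k ℕ.* n))

    Chat%≡value% : ∀ n → Chat k u n b c % + m ≡ value (state (k ℕ.* n)) origin % + m
    Chat%≡value% n = ≡ₘ⇒%≡ (subst (_≡ₘ value (state (k ℕ.* n)) origin) (sym (Chat≡walkSum n))
                                   (walkSum≡ₘvalue (k ℕ.* n) origin))

    Chat%-eventuallyPeriodic : EventuallyPeriodic (λ n → Chat k u n b c % + m)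
    Chat%-eventuallyPeriodic = eventuallyPeriodic-factor (λ S → value S origin % + m) Chat%≡value%
      (Orbit.finite⇒eventuallyPeriodic (λ S → fold S transfer k) (λ n → state (k ℕ.* n)) state-k*-suc
        encodeVec encodeVec-injective)

open import Data.Nat using (_+_; _≤_; _<_)

theorem3p1 : (k m u : ℕ) → 2 ≤ k → .{{_ : NonZero m}} → 0 < u → (b c : ℕ → ℤ) →
    ∃₂ λ (N p : ℕ) → 0 < p × (∀ n → N ≤ n →
      Chat k u (n + p) b c % (+ m) ≡ Chat k u n b c % (+ m))
theorem3p1 zero      m u ()
theorem3p1 (suc k-1) m u _ _ b c = Walks.Residues.Chat%-eventuallyPeriodic k-1 u b c m
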